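{- Let $i,j\in\mathbb{N}$ and $n\in\mathbb{N}_0$. If $d_j(n+1)=d_i(n)+1$ or $d_j(n+1)=d_i(n)-1$, then $d_j(n+1)+d_i(n)=d_\ell(2n+1)$ for some $\ell\in\{3,\,i+1,\,j+1\}$.
   Context: For $i\in\mathbb{N}$ and $n\in\mathbb{N}_0$, $d_i(n)=2^{i-1}-\left|(n \bmod 2^i)-2^{i-1}\right|$ (equivalently, for $n\ge 1$ and $i\le\lceil\lg n\rceil$, the number of $0$'s minus the number of $1$'s among the $i$-th binary coordinates of $0,1,\ldots,n-1$); in particular $d_i(0)=0$. -}

module Defs where

open import Data.Nat using (ℕ; suc; _^_; _%_)
open import Data.Nat.Properties using (m^n≢0)
open import Data.Integer using (ℤ; +_; _-_; ∣_∣)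

-- d i n = 2^(i-1) - |(n mod 2^i) - 2^(i-1)|, as an integer.
-- Intended for i ≥ 1 (the statement assumes 1 ≤ i); for i = 0 the value is junk.
d : ℕ → ℕ → ℤ
d i n = (+ (2 ^ (i Data.Nat.∸ 1))) - (+ ∣ (+ (_%_ n (2 ^ i) {{m^n≢0 2 i}})) - (+ (2 ^ (i Data.Nat.∸ 1))) ∣)

-- d i is the triangle wave n ↦ distance from n to the nearest multiple of 2^i; it moves by ±1 at each
-- step, and since no multiple of 2^i lies strictly between n and n+1,
--   d i (n+1) + d i n = 2 · dist(n + 1/2, 2^i ℤ) = d (i+1) (2n+1).
-- Write d j (n+1) = d i n ± 1. If d i (n+1) = d i n ± 1 with the same sign, then d j (n+1) = d i (n+1)
-- and ℓ = i+1; if d j n = d j (n+1) ∓ 1, then d j n = d i n and ℓ = j+1. Otherwise both waves rise with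
-- d i n = d j n + 2, or both fall with d j (n+1) = d i (n+1) + 2. Then n is congruent to two numbers
-- differing by 2 modulo 2^i and modulo 2^j, impossible modulo 4 unless i or j is 1; in the remaining
-- cases n is fixed modulo 8 and both sides equal 3 = d 3 (2n+1).
module Submission where

open import Algebra.Properties.CommutativeSemigroup using (x∙yz≈y∙xz)
open import Data.Empty using (⊥-elim)
open import Data.Integer as ℤ using (ℤ; _⊖_; 1ℤ)
import Data.Integer.Properties as ℤ
open import Data.Nat using (ℕ; zero; suc; _+_; _*_; _∸_; _^_; _%_; _/_; _≤_; _<_; ∣_-_∣; z≤n; s≤s; s≤s⁻¹; z<s)
open import Data.Nat.Divisibility using (_∣_; divides; ∣⇒≤; ∣m+n∣m⇒∣n; ∣n⇒∣m*n; m∣m*n)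
open import Data.Nat.DivMod using (m≡m%n+[m/n]*n; [m+kn]%n≡m%n; m<n⇒m%n≡m; m%n<n)
open import Data.Nat.Properties
open import Data.Nat.Tactic.RingSolver using (solve-∀)
open import Data.Product using (∃-syntax; _×_; _,_)
open import Data.Sum using (_⊎_; inj₁; inj₂)
import Data.Sum as Sum
open import Function using (_∘_)
open import Relation.Binary.PropositionalEquality
open import Relation.Nullary using (yes; no; contradiction)

open import Defs

-- tri k = d (suc k) (see d≡tri), indexed so that the period is 2 ^ suc k and the peak 2 ^ k.
tri : ℕ → ℕ → ℕ
tri k n = 2 ^ k ∸ ∣ n % 2 ^ suc k - 2 ^ k ∣
  where instance _ = m^n≢0 2 (suc k)

tri-≤ : ∀ k n → tri k n ≤ 2 ^ k
tri-≤ k n = m∸n≤m (2 ^ k) ∣ n % 2 ^ suc k - 2 ^ k ∣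
  where instance _ = m^n≢0 2 (suc k)

≤2^k⇒<2^[1+k] : ∀ k {e} → e ≤ 2 ^ k → e < 2 ^ suc k
≤2^k⇒<2^[1+k] k e≤ = ≤-<-trans e≤ (m<m+n (2 ^ k) (subst (0 <_) (sym (+-identityʳ _)) (m^n>0 2 k)))

tri-residue : ∀ k q {r} → r < 2 ^ suc k → tri k (r + q * 2 ^ suc k) ≡ 2 ^ k ∸ ∣ r - 2 ^ k ∣
tri-residue k q {r} r< =
  cong (λ x → 2 ^ k ∸ ∣ x - 2 ^ k ∣) (trans ([m+kn]%n≡m%n r q (2 ^ suc k)) (m<n⇒m%n≡m r<))
  where instance _ = m^n≢0 2 (suc k)

tri-+ : ∀ k q {e} → e ≤ 2 ^ k → tri k (e + q * 2 ^ suc k) ≡ e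
tri-+ k q {e} e≤ = begin
  tri k (e + q * 2 ^ suc k)  ≡⟨ tri-residue k q (≤2^k⇒<2^[1+k] k e≤) ⟩
  2 ^ k ∸ ∣ e - 2 ^ k ∣      ≡⟨ cong (2 ^ k ∸_) (m≤n⇒∣m-n∣≡n∸m e≤) ⟩
  2 ^ k ∸ (2 ^ k ∸ e)        ≡⟨ m∸[m∸n]≡n e≤ ⟩
  e                          ∎
  where open ≡-Reasoning

tri-upper-half : ∀ k q {s} → s < 2 ^ k → tri k (2 ^ k + s + q * 2 ^ suc k) ≡ 2 ^ k ∸ s
tri-upper-half k q {s} s< = trans (tri-residue k q 2^k+s<)
  (cong (2 ^ k ∸_) (trans (∣-∣-comm (2 ^ k + s) (2 ^ k)) (∣m-m+n∣≡n (2 ^ k) s)))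
  where
  2^k+s< : 2 ^ k + s < 2 ^ suc k
  2^k+s< = +-monoʳ-< (2 ^ k) (subst (s <_) (sym (+-identityʳ _)) s<)

complete-period : ∀ k q {s e} → s + e ≡ 2 ^ k → 2 ^ k + s + q * 2 ^ suc k + e ≡ suc q * 2 ^ suc k
complete-period k q {s} {e} s+e≡ = begin
  2 ^ k + s + q * 2 ^ suc k + e    ≡⟨ shuffle (2 ^ k) s (q * 2 ^ suc k) e ⟩
  2 ^ k + (s + e) + q * 2 ^ suc k  ≡⟨ cong (λ x → 2 ^ k + x + q * 2 ^ suc k) s+e≡ ⟩
  2 ^ k + 2 ^ k + q * 2 ^ suc k    ≡⟨ cong (λ x → 2 ^ k + x + q * 2 ^ suc k) (+-identityʳ _) ⟨
  suc q * 2 ^ suc k                ∎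
  where
  open ≡-Reasoning
  shuffle : ∀ p s x e → p + s + x + e ≡ p + (s + e) + x
  shuffle = solve-∀

tri-complement : ∀ k q {n e} → e ≤ 2 ^ k → n + e ≡ q * 2 ^ suc k → tri k n ≡ e
tri-complement k q {n} {zero} _ n+0≡ =
  trans (cong (tri k) (trans (sym (+-identityʳ n)) n+0≡)) (tri-+ k q z≤n)
tri-complement k zero {n} {suc e} _ n+e≡0 = contradiction n+e≡0 (m+1+n≢0 n)
tri-complement k (suc q) {n} {suc e} e≤ n+e≡ = begin
  tri k n                           ≡⟨ cong (tri k) n≡ ⟩
  tri k (2 ^ k + s + q * 2 ^ suc k) ≡⟨ tri-upper-half k q (subst (s <_) s+e≡ (m<m+n s z<s)) ⟩
  2 ^ k ∸ s                         ≡⟨ cong (_∸ s) s+e≡ ⟨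
  s + suc e ∸ s                     ≡⟨ m+n∸m≡n s (suc e) ⟩
  suc e                             ∎
  where
  open ≡-Reasoning
  s : ℕ
  s = 2 ^ k ∸ suc e
  s+e≡ : s + suc e ≡ 2 ^ k
  s+e≡ = m∸n+n≡m e≤
  n≡ : n ≡ 2 ^ k + s + q * 2 ^ suc k
  n≡ = +-cancelʳ-≡ (suc e) n _ (trans n+e≡ (sym (complete-period k q s+e≡)))

Rising : ℕ → ℕ → Set
Rising k n = ∃[ q ] (n ≡ tri k n + q * 2 ^ suc k) × (tri k (suc n) ≡ suc (tri k n))

Falling : ℕ → ℕ → Set
Falling k n = ∃[ q ] (suc n + tri k (suc n) ≡ q * 2 ^ suc k) × (tri k n ≡ suc (tri k (suc n)))

rising-or-falling : ∀ k n → Rising k n ⊎ Falling k n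
rising-or-falling k n = from-residue (n / 2 ^ suc k) (m%n<n n (2 ^ suc k)) (m≡m%n+[m/n]*n n (2 ^ suc k))
  where
  instance _ = m^n≢0 2 (suc k)
  from-residue : ∀ q {r} → r < 2 ^ suc k → n ≡ r + q * 2 ^ suc k → Rising k n ⊎ Falling k n
  from-residue q {r} r< n≡ with r <? 2 ^ k
  ... | yes r<2^k = inj₁ (q , trans n≡ (cong (_+ q * 2 ^ suc k) (sym tri≡r)) ,
                          trans (cong (tri k ∘ suc) n≡) (trans (tri-+ k q r<2^k) (cong suc (sym tri≡r))))
    where
    tri≡r : tri k n ≡ r
    tri≡r = trans (cong (tri k) n≡) (tri-+ k q (<⇒≤ r<2^k))
  ... | no r≮2^k =
    inj₂ (suc q , trans (cong (suc n +_) tri[1+n]≡b) sn+b≡ , trans tri[n]≡1+b (cong suc (sym tri[1+n]≡b)))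
    where
    2^k≤r : 2 ^ k ≤ r
    2^k≤r = ≮⇒≥ r≮2^k
    s : ℕ
    s = r ∸ 2 ^ k
    s<2^k : s < 2 ^ k
    s<2^k = +-cancelˡ-< (2 ^ k) s (2 ^ k)
      (subst₂ _<_ (sym (m+[n∸m]≡n 2^k≤r)) (cong (2 ^ k +_) (+-identityʳ _)) r<)
    b : ℕ
    b = 2 ^ k ∸ suc s
    s+1+b≡ : s + suc b ≡ 2 ^ k
    s+1+b≡ = trans (+-suc s b) (m+[n∸m]≡n s<2^k)
    n+1+b≡ : n + suc b ≡ suc q * 2 ^ suc k
    n+1+b≡ = trans (cong (_+ suc b) (trans n≡ (cong (_+ q * 2 ^ suc k) (sym (m+[n∸m]≡n 2^k≤r)))))
      (complete-period k q s+1+b≡)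
    sn+b≡ : suc n + b ≡ suc q * 2 ^ suc k
    sn+b≡ = trans (sym (+-suc n b)) n+1+b≡
    1+b≤2^k : suc b ≤ 2 ^ k
    1+b≤2^k = subst (suc b ≤_) s+1+b≡ (m≤n+m (suc b) s)
    tri[n]≡1+b : tri k n ≡ suc b
    tri[n]≡1+b = tri-complement k (suc q) 1+b≤2^k n+1+b≡
    tri[1+n]≡b : tri k (suc n) ≡ b
    tri[1+n]≡b = tri-complement k (suc q) (≤-trans (n≤1+n b) 1+b≤2^k) sn+b≡

rising-bound : ∀ k n → Rising k n → suc (tri k n) ≤ 2 ^ k
rising-bound k n (_ , _ , up) = subst (_≤ 2 ^ k) up (tri-≤ k (suc n))

falling-bound : ∀ k n → Falling k n → suc (tri k (suc n)) ≤ 2 ^ k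
falling-bound k n (_ , _ , down) = subst (_≤ 2 ^ k) down (tri-≤ k n)

m+1+m≤2*n : ∀ {m n} → suc m ≤ n → m + suc m ≤ 2 * n
m+1+m≤2*n {n = n} m<n = +-mono-≤ (<⇒≤ m<n) (≤-trans m<n (m≤m+n n 0))

tri-adjacent-sum : ∀ k n → tri k (suc n) + tri k n ≡ tri (suc k) (suc (2 * n))
tri-adjacent-sum k n with rising-or-falling k n
... | inj₁ r@(q , n≡ , up) = begin
  tri k (suc n) + tri k n                       ≡⟨ cong (_+ a) up ⟩
  suc a + a                                     ≡⟨ tri-+ (suc k) q 1+a+a≤ ⟨
  tri (suc k) (suc a + a + q * 2 ^ suc (suc k)) ≡⟨ cong (tri (suc k)) 2n+1≡ ⟨
  tri (suc k) (suc (2 * n))                     ∎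
  where
  open ≡-Reasoning
  a = tri k n
  doubling : ∀ a q t → suc (2 * (a + q * t)) ≡ suc a + a + q * (2 * t)
  doubling = solve-∀
  1+a+a≤ : suc a + a ≤ 2 ^ suc k
  1+a+a≤ = subst (_≤ 2 ^ suc k) (+-suc a a) (m+1+m≤2*n (rising-bound k n r))
  2n+1≡ : suc (2 * n) ≡ suc a + a + q * 2 ^ suc (suc k)
  2n+1≡ = trans (cong (λ x → suc (2 * x)) n≡) (doubling a q (2 ^ suc k))
... | inj₂ f@(q , sn+b≡ , down) = begin
  tri k (suc n) + tri k n    ≡⟨ cong (b +_) down ⟩
  b + suc b                  ≡⟨ tri-complement (suc k) q (m+1+m≤2*n (falling-bound k n f)) 2n+1+b+1+b≡ ⟨
  tri (suc k) (suc (2 * n))  ∎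
  where
  open ≡-Reasoning
  b = tri k (suc n)
  doubling : ∀ n b q t → suc n + b ≡ q * t → suc (2 * n) + (b + suc b) ≡ q * (2 * t)
  doubling n b q t eq = trans (double n b) (trans (cong (2 *_) eq) (swap q t))
    where
    double : ∀ n b → suc (2 * n) + (b + suc b) ≡ 2 * (suc n + b)
    double = solve-∀
    swap : ∀ q t → 2 * (q * t) ≡ q * (2 * t)
    swap = solve-∀
  2n+1+b+1+b≡ : suc (2 * n) + (b + suc b) ≡ q * 2 ^ suc (suc k)
  2n+1+b+1+b≡ = doubling n b q (2 ^ suc k) sn+b≡

2^m∣2^[m+n] : ∀ m n → 2 ^ m ∣ 2 ^ (m + n)
2^m∣2^[m+n] m n = subst (2 ^ m ∣_) (sym (^-distribˡ-+-* 2 m n)) (m∣m*n (2 ^ n))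

4∣m⇒4∣n⇒2+m≢n : ∀ {m n} → 4 ∣ m → 4 ∣ n → 2 + m ≢ n
4∣m⇒4∣n⇒2+m≢n {m} 4∣m 4∣n 2+m≡n
  with ∣⇒≤ (∣m+n∣m⇒∣n (subst (4 ∣_) (sym (trans (+-comm m 2) 2+m≡n)) 4∣n) 4∣m)
... | s≤s (s≤s ())

tri-2[1+2n]≡3-when-n≡2 : ∀ {n} c → n ≡ 2 + c * 8 → tri 2 (suc (2 * n)) ≡ 3
tri-2[1+2n]≡3-when-n≡2 c refl =
  tri-complement 2 (suc (2 * c)) {suc (2 * (2 + c * 8))} (n≤1+n 3) (identity c)
  where
  identity : ∀ c → suc (2 * (2 + c * 8)) + 3 ≡ suc (2 * c) * 8
  identity = solve-∀

tri-2[1+2n]≡3-when-n≡-3 : ∀ {n} c → suc n + 2 ≡ c * 8 → tri 2 (suc (2 * n)) ≡ 3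
tri-2[1+2n]≡3-when-n≡-3 {n} (suc c) n+3≡ = begin
  tri 2 (suc (2 * n))            ≡⟨ cong (λ x → tri 2 (suc (2 * x))) n≡ ⟩
  tri 2 (suc (2 * (5 + c * 8)))  ≡⟨ cong (tri 2) (identity c) ⟩
  tri 2 (3 + suc (2 * c) * 8)    ≡⟨ tri-+ 2 (suc (2 * c)) (n≤1+n 3) ⟩
  3                              ∎
  where
  open ≡-Reasoning
  n≡ : n ≡ 5 + c * 8
  n≡ = +-cancelʳ-≡ 2 n (5 + c * 8) (trans (suc-injective n+3≡) (sym (+-comm (5 + c * 8) 2)))
  identity : ∀ c → suc (2 * (5 + c * 8)) ≡ 3 + suc (2 * c) * 8
  identity = solve-∀

rising-rising : ∀ k m n → Rising k n → Rising m n → tri k n ≡ 2 + tri m n →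
                tri m (suc n) + tri k n ≡ tri 2 (suc (2 * n))
rising-rising zero m n _ _ gap = contradiction (subst (_≤ 1) gap (tri-≤ 0 n)) λ { (s≤s ()) }
rising-rising (suc zero) m n r _ gap =
  contradiction (subst (λ x → suc x ≤ 2) gap (rising-bound 1 n r)) λ { (s≤s (s≤s ())) }
rising-rising (suc (suc k)) zero n (q , n≡ , _) r₀@(_ , _ , up₀) gap
  with ∣n⇒∣m*n q (2^m∣2^[m+n] 3 k)
... | divides c qT≡c*8 = begin
  tri 0 (suc n) + tri (2 + k) n  ≡⟨ cong₂ _+_ (trans up₀ (cong suc a≡0)) (trans gap (cong (2 +_) a≡0)) ⟩
  3                              ≡⟨ tri-2[1+2n]≡3-when-n≡2 c n≡2+8c ⟨
  tri 2 (suc (2 * n))            ∎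
  where
  open ≡-Reasoning
  a≡0 : tri 0 n ≡ 0
  a≡0 = n≤0⇒n≡0 (s≤s⁻¹ (rising-bound 0 n r₀))
  n≡2+8c : n ≡ 2 + c * 8
  n≡2+8c = trans n≡ (cong₂ _+_ (trans gap (cong (2 +_) a≡0)) qT≡c*8)
rising-rising (suc k) (suc m) n (q , n≡q , _) (p , n≡p , _) gap =
  ⊥-elim (4∣m⇒4∣n⇒2+m≢n (∣n⇒∣m*n q (2^m∣2^[m+n] 2 k)) (∣n⇒∣m*n p (2^m∣2^[m+n] 2 m)) 2+qT≡pT)
  where
  open ≡-Reasoning
  a = tri (suc m) n
  2+qT≡pT : 2 + q * 2 ^ (2 + k) ≡ p * 2 ^ (2 + m)
  2+qT≡pT = +-cancelˡ-≡ a _ _ (begin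
    a + (2 + q * 2 ^ (2 + k))        ≡⟨ x∙yz≈y∙xz +-commutativeSemigroup a 2 _ ⟩
    2 + a + q * 2 ^ (2 + k)          ≡⟨ cong (_+ q * 2 ^ (2 + k)) gap ⟨
    tri (suc k) n + q * 2 ^ (2 + k)  ≡⟨ n≡q ⟨
    n                                ≡⟨ n≡p ⟩
    a + p * 2 ^ (2 + m)              ∎)

falling-falling : ∀ k m n → Falling k n → Falling m n → tri m (suc n) ≡ 2 + tri k (suc n) →
                  tri m (suc n) + tri k n ≡ tri 2 (suc (2 * n))
falling-falling k zero n _ _ gap = contradiction (subst (_≤ 1) gap (tri-≤ 0 (suc n))) λ { (s≤s ()) }
falling-falling k (suc zero) n _ f gap =
  contradiction (subst (λ x → suc x ≤ 2) gap (falling-bound 1 n f)) λ { (s≤s (s≤s ())) }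
falling-falling zero (suc (suc m)) n f₀@(_ , _ , down₀) (p , sn+b≡ , _) gap
  with ∣n⇒∣m*n p (2^m∣2^[m+n] 3 m)
... | divides c pT≡c*8 = begin
  tri (2 + m) (suc n) + tri 0 n  ≡⟨ cong₂ _+_ (trans gap (cong (2 +_) b≡0)) (trans down₀ (cong suc b≡0)) ⟩
  3                              ≡⟨ tri-2[1+2n]≡3-when-n≡-3 c n+3≡8c ⟨
  tri 2 (suc (2 * n))            ∎
  where
  open ≡-Reasoning
  b≡0 : tri 0 (suc n) ≡ 0
  b≡0 = n≤0⇒n≡0 (s≤s⁻¹ (falling-bound 0 n f₀))
  n+3≡8c : suc n + 2 ≡ c * 8
  n+3≡8c = trans (cong (suc n +_) (sym (trans gap (cong (2 +_) b≡0)))) (trans sn+b≡ pT≡c*8)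
falling-falling (suc k) (suc m) n (q , sn+b≡q , _) (p , sn+b≡p , _) gap =
  ⊥-elim (4∣m⇒4∣n⇒2+m≢n (∣n⇒∣m*n q (2^m∣2^[m+n] 2 k)) (∣n⇒∣m*n p (2^m∣2^[m+n] 2 m)) 2+qT≡pT)
  where
  open ≡-Reasoning
  b = tri (suc k) (suc n)
  2+qT≡pT : 2 + q * 2 ^ (2 + k) ≡ p * 2 ^ (2 + m)
  2+qT≡pT = begin
    2 + q * 2 ^ (2 + k)          ≡⟨ cong (2 +_) sn+b≡q ⟨
    2 + (suc n + b)              ≡⟨ x∙yz≈y∙xz +-commutativeSemigroup (suc n) 2 b ⟨
    suc n + (2 + b)              ≡⟨ cong (suc n +_) gap ⟨
    suc n + tri (suc m) (suc n)  ≡⟨ sn+b≡p ⟩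
    p * 2 ^ (2 + m)              ∎

tri[1+n]-agree⇒sum : ∀ k m n → tri m (suc n) ≡ tri k (suc n) →
                     tri m (suc n) + tri k n ≡ tri (suc k) (suc (2 * n))
tri[1+n]-agree⇒sum k m n eq = trans (cong (_+ tri k n) eq) (tri-adjacent-sum k n)

tri[n]-agree⇒sum : ∀ k m n → tri k n ≡ tri m n → tri m (suc n) + tri k n ≡ tri (suc m) (suc (2 * n))
tri[n]-agree⇒sum k m n eq = trans (cong (tri m (suc n) +_) eq) (tri-adjacent-sum m n)

tri-neighbour-sum : ∀ k m n → (tri m (suc n) ≡ suc (tri k n)) ⊎ (suc (tri m (suc n)) ≡ tri k n) →
  ∃[ l ] ((l ≡ 2 ⊎ l ≡ suc k ⊎ l ≡ suc m) × (tri m (suc n) + tri k n ≡ tri l (suc (2 * n))))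
tri-neighbour-sum k m n h with rising-or-falling k n | h
... | inj₁ (_ , _ , up)   | inj₁ h₁ =
  suc k , inj₂ (inj₁ refl) , tri[1+n]-agree⇒sum k m n (trans h₁ (sym up))
... | inj₂ (_ , _ , down) | inj₂ h₂ =
  suc k , inj₂ (inj₁ refl) , tri[1+n]-agree⇒sum k m n (suc-injective (trans h₂ down))
... | inj₁ r | inj₂ h₂ with rising-or-falling m n
...   | inj₁ r′@(_ , _ , up′) = 2 , inj₁ refl , rising-rising k m n r r′ (trans (sym h₂) (cong suc up′))
...   | inj₂ (_ , _ , down′)  =
  suc m , inj₂ (inj₂ refl) , tri[n]-agree⇒sum k m n (trans (sym h₂) (sym down′))
tri-neighbour-sum k m n h | inj₂ f@(_ , _ , down) | inj₁ h₁ with rising-or-falling m n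
...   | inj₁ (_ , _ , up′) =
  suc m , inj₂ (inj₂ refl) , tri[n]-agree⇒sum k m n (suc-injective (trans (sym h₁) up′))
...   | inj₂ f′            = 2 , inj₁ refl , falling-falling k m n f f′ (trans h₁ (cong suc down))

∣m⊖n∣≡∣m-n∣ : ∀ m n → ℤ.∣ m ⊖ n ∣ ≡ ∣ m - n ∣
∣m⊖n∣≡∣m-n∣ m n with ≤-total m n
... | inj₁ m≤n = trans (ℤ.∣⊖∣-≤ m≤n) (sym (m≤n⇒∣m-n∣≡n∸m m≤n))
... | inj₂ n≤m = trans (ℤ.∣m⊖n∣≡∣n⊖m∣ m n) (trans (ℤ.∣⊖∣-≤ n≤m) (sym (m≤n⇒∣n-m∣≡n∸m n≤m)))

m<n+n⇒∣m-n∣≤n : ∀ {m n} → m < n + n → ∣ m - n ∣ ≤ n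
m<n+n⇒∣m-n∣≤n {m} {n} m< with ≤-total m n
... | inj₁ m≤n = subst (_≤ n) (sym (m≤n⇒∣m-n∣≡n∸m m≤n)) (m∸n≤m n m)
... | inj₂ n≤m = subst₂ _≤_ (sym (m≤n⇒∣n-m∣≡n∸m n≤m)) (m+n∸m≡n n n) (∸-monoˡ-≤ n (<⇒≤ m<))

d≡tri : ∀ k n → d (suc k) n ≡ ℤ.+ tri k n
d≡tri k n = begin
  ℤ.+ (2 ^ k) ℤ.- ℤ.+ ℤ.∣ ℤ.+ r ℤ.- ℤ.+ (2 ^ k) ∣  ≡⟨ cong (λ x → ℤ.+ (2 ^ k) ℤ.- ℤ.+ x) ∣r-2^k∣ ⟩
  ℤ.+ (2 ^ k) ℤ.- ℤ.+ ∣ r - 2 ^ k ∣               ≡⟨ ℤ.m-n≡m⊖n (2 ^ k) ∣ r - 2 ^ k ∣ ⟩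
  2 ^ k ⊖ ∣ r - 2 ^ k ∣                           ≡⟨ ℤ.⊖-≥ (m<n+n⇒∣m-n∣≤n r<) ⟩
  ℤ.+ tri k n                                     ∎
  where
  open ≡-Reasoning
  instance _ = m^n≢0 2 (suc k)
  r = n % 2 ^ suc k
  r< : r < 2 ^ k + 2 ^ k
  r< = subst (r <_) (cong (2 ^ k +_) (+-identityʳ _)) (m%n<n n (2 ^ suc k))
  ∣r-2^k∣ : ℤ.∣ ℤ.+ r ℤ.- ℤ.+ (2 ^ k) ∣ ≡ ∣ r - 2 ^ k ∣
  ∣r-2^k∣ = trans (cong ℤ.∣_∣ (ℤ.m-n≡m⊖n r (2 ^ k))) (∣m⊖n∣≡∣m-n∣ r (2 ^ k))

+b≡+a+1⇒b≡1+a : ∀ {a b} → ℤ.+ b ≡ ℤ.+ a ℤ.+ 1ℤ → b ≡ suc a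
+b≡+a+1⇒b≡1+a {a} eq = trans (ℤ.+-injective eq) (+-comm a 1)

+b≡+a-1⇒1+b≡a : ∀ {a b} → ℤ.+ b ≡ ℤ.+ a ℤ.- 1ℤ → suc b ≡ a
+b≡+a-1⇒1+b≡a {suc a} eq = cong suc (ℤ.+-injective eq)

lemma12 : (i j n : ℕ) → 1 ≤ i → 1 ≤ j →
    (d j (suc n) ≡ d i n ℤ.+ 1ℤ) ⊎ (d j (suc n) ≡ d i n ℤ.- 1ℤ) →
    ∃[ ℓ ] ((ℓ ≡ 3 ⊎ ℓ ≡ suc i ⊎ ℓ ≡ suc j) × (d j (suc n) ℤ.+ d i n ≡ d ℓ (suc (2 * n))))
lemma12 (suc k) (suc m) n _ _ h
  with tri-neighbour-sum k m n
         (Sum.map (+b≡+a+1⇒b≡1+a ∘ in-tri (ℤ._+ 1ℤ)) (+b≡+a-1⇒1+b≡a ∘ in-tri (ℤ._- 1ℤ)) h)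
  where
  in-tri : ∀ (f : ℤ → ℤ) → d (suc m) (suc n) ≡ f (d (suc k) n) → ℤ.+ tri m (suc n) ≡ f (ℤ.+ tri k n)
  in-tri f = subst₂ (λ x y → x ≡ f y) (d≡tri m (suc n)) (d≡tri k n)
... | l , l∈ , sum≡ = suc l , Sum.map (cong suc) (Sum.map (cong suc) (cong suc)) l∈ , (begin
  d (suc m) (suc n) ℤ.+ d (suc k) n  ≡⟨ cong₂ ℤ._+_ (d≡tri m (suc n)) (d≡tri k n) ⟩
  ℤ.+ (tri m (suc n) + tri k n)      ≡⟨ cong ℤ.+_ sum≡ ⟩
  ℤ.+ tri l (suc (2 * n))            ≡⟨ d≡tri l (suc (2 * n)) ⟨
  d (suc l) (suc (2 * n))            ∎)
  where open ≡-Reasoning
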